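{- For every integer $n\ge 5$ and every integer $t$ with $n-2\le t\le \frac{n^2}{8}+\frac{n}{4}-\frac{11}{8}$, there exists an $(n,t)$-blocker.
   Context: For a convex $n$-gon, a triangulation is a maximal set of pairwise non-crossing diagonals (crossing = sharing an interior point). A blocker is a set of edges sharing an edge with every triangulation; it is saturated if removing any of its edges yields a non-blocker. An $(n,t)$-blocker is a saturated blocker with exactly $t$ edges for a convex $n$-gon. -}

module Defs where

open import Data.Nat using (ℕ; zero; suc; _+_; _*_; _≤_; _<_)
open import Data.Fin using (Fin; toℕ)
open import Data.Product using (_×_; _,_; ∃-syntax)
open import Data.Sum using (_⊎_)
open import Data.List using (List; length)
open import Data.List.Membership.Propositional using (_∈_; _∉_)
open import Data.List.Relation.Unary.Unique.Propositional using (Unique)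
open import Relation.Nullary using (¬_)
open import Relation.Binary.PropositionalEquality using (_≡_; _≢_)

-- Vertices of the convex n-gon are 0,1,…,n-1 (as Fin n) in cyclic order.
-- An edge (segment between two vertices) is represented by the ordered pair
-- (i , j) with i < j.
Edge : ℕ → Set
Edge n = Fin n × Fin n

-- (i , j) is a diagonal: i < j, not adjacent on the boundary,
-- i.e. j ≠ i+1 and (i , j) ≠ (0 , n-1).
IsDiagonal : ∀ {n} → Edge n → Set
IsDiagonal {n} (i , j) =
  (suc (toℕ i) < toℕ j) × ¬ ((toℕ i ≡ 0) × (suc (toℕ j) ≡ n))

-- Two segments (a,b), (c,d) (a<b, c<d) between vertices in convex position
-- share an interior point iff their endpoints strictly interleave.
Cross : ∀ {n} → Edge n → Edge n → Set
Cross (a , b) (c , d) =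
  ((toℕ a < toℕ c) × (toℕ c < toℕ b) × (toℕ b < toℕ d))
  ⊎ ((toℕ c < toℕ a) × (toℕ a < toℕ d) × (toℕ d < toℕ b))

record IsTriangulation {n : ℕ} (T : List (Edge n)) : Set where
  field
    diagonals   : ∀ e → e ∈ T → IsDiagonal e
    nonCrossing : ∀ e f → e ∈ T → f ∈ T → ¬ Cross e f
    maximal     : ∀ d → IsDiagonal d → d ∉ T → ∃[ e ] (e ∈ T × Cross d e)

IsBlocker : ∀ {n} → (Edge n → Set) → Set
IsBlocker {n} S =
  (∀ e → S e → IsDiagonal e) ×
  (∀ (T : List (Edge n)) → IsTriangulation T → ∃[ e ] (S e × e ∈ T))

IsSaturatedBlocker : ∀ {n} → List (Edge n) → Set
IsSaturatedBlocker B =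
  IsBlocker (_∈ B) ×
  (∀ e → e ∈ B → ¬ IsBlocker (λ x → x ∈ B × x ≢ e))

IsNTBlocker : (n t : ℕ) → List (Edge n) → Set
IsNTBlocker n t B = Unique B × length B ≡ t × IsSaturatedBlocker B

-- Split the vertices 0, …, n − 1 into four consecutive arcs I₁, I₂, I₃, I₄ of sizes a, b, c, d
-- and take every diagonal from I₁ to I₃ or from I₂ to I₄: ac + bd edges.  They meet every
-- triangulation T: starting from the boundary edge between I₂ and I₃, an I₂–I₃ side x–y of T
-- can always be replaced by a strictly wider edge of T through x or y (an edge of the
-- triangle of T on the outer side of x–y), and this stops only when the new endpoint lies in
-- I₁ or I₄, i.e. at an edge of the blocker.  The blocker is saturated: each of its edges e is
-- a diagonal of a convex quadrilateral whose sides, together with e, are pairwise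
-- non-crossing but cross every other edge of the blocker, so a triangulation containing them
-- meets the blocker only in e.  Finally, with c = d + 1 the values ac + bd for
-- a + b + c + d = n fill overlapping intervals covering [n − 2, (n² + 2n − 11)/8].

module Submission where

open import Defs
open import Data.Nat using (ℕ; zero; suc; _+_; _*_; _∸_; _≤_; _<_; _≤?_; _<?_; z≤n; s≤s; z<s)
open import Data.Nat.Properties
open import Data.Nat.DivMod using (_divMod_; result)
open import Data.Nat.Induction using (<-wellFounded)
open import Data.Nat.Tactic.RingSolver using (solve)
open import Induction.WellFounded using (Acc; acc)
open import Data.Fin using (Fin; toℕ; fromℕ<)
open import Data.Fin.Properties using (toℕ<n; toℕ-injective; toℕ-fromℕ<) renaming (_≟_ to _≟ᶠ_)
open import Data.Product using (_×_; _,_; ∃-syntax; proj₁; proj₂)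
open import Data.Product.Properties using (≡-dec)
open import Data.Sum using (_⊎_; inj₁; inj₂)
open import Data.List using (List; []; _∷_; _++_; map; length; foldr; filter; tabulate; cartesianProduct; allFin)
open import Data.List.Properties using (length-++; length-map; length-tabulate)
open import Data.List.Membership.Propositional using (_∈_; _∉_; find; lose)
open import Data.List.Membership.Propositional.Properties
  using (∈-allFin; ∈-tabulate⁺; ∈-tabulate⁻; ∈-filter⁺; ∈-filter⁻; ∈-cartesianProduct⁺; ∈-cartesianProduct⁻; ∈-++⁺ˡ; ∈-++⁺ʳ; ∈-++⁻)
open import Data.List.Relation.Unary.Any using (Any; here; there; any?)
open import Data.List.Relation.Unary.Unique.Propositional using (Unique)
import Data.List.Relation.Unary.Unique.Propositional.Properties as Unique
open import Data.List.Relation.Binary.Subset.Propositional using (_⊆_)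
open import Function using (_∘_)
open import Relation.Nullary using (¬_; Dec; yes; no; contradiction)
open import Relation.Nullary.Decidable using (_×-dec_; _⊎-dec_; ¬?)
open import Relation.Binary using (tri<; tri≈; tri>)
open import Relation.Binary.PropositionalEquality

-- Four arc sizes with ac + bd = t

ArcSplit : ℕ → ℕ → Set
ArcSplit n t = ∃[ a ] ∃[ b ] ∃[ c ] ∃[ d ]
  (suc a + suc b + suc c + suc d ≡ n × suc a * suc c + suc b * suc d ≡ t)

arcSplit-top : ∀ k o j → ArcSplit (5 + (o + j + 2 * k)) (suc ((o + j + 2) * (k + 1) + o))
arcSplit-top k o j = o , j , suc k , k , solve (o ∷ j ∷ k ∷ []) , solve (o ∷ j ∷ k ∷ [])

-- With c = k + 2, d = k + 1 and a + b = N + 2, the value ac + bd = (N + 2)(k + 1) + a sweeps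
-- the top of the interval; below it, trade one unit of k for two units of N (same n).
arcSplit-interval : ∀ k N t → 3 + (N + 2 * k) ≤ t → t ≤ suc ((N + 2) * (k + 1) + N) →
                    ArcSplit (5 + (N + 2 * k)) t
arcSplit-interval k N t lo hi with t ≤? (N + 2) * (k + 1)
... | no t≰L with m≤n⇒∃[o]m+o≡n (≰⇒> t≰L)
...   | o , refl with m≤n⇒∃[o]m+o≡n (+-cancelˡ-≤ _ o N (≤-pred hi))
...     | j , refl = arcSplit-top k o j
arcSplit-interval zero N t lo hi | yes t≤L =
  contradiction (≤-trans lo t≤L) (<⇒≱ (≤-reflexive 1+L≡lo))
  where
  1+L≡lo : suc ((N + 2) * (0 + 1)) ≡ 3 + (N + 2 * 0)
  1+L≡lo = solve (N ∷ [])
arcSplit-interval (suc k) N t lo hi | yes t≤L =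
  subst (λ m → ArcSplit (5 + m) t) shift
    (arcSplit-interval k (2 + N) t (subst (λ m → 3 + m ≤ t) (sym shift) lo) t≤L′)
  where
  shift : 2 + N + 2 * k ≡ N + 2 * suc k
  shift = solve (N ∷ k ∷ [])
  open ≤-Reasoning
  t≤L′ : t ≤ suc ((2 + N + 2) * (k + 1) + (2 + N))
  t≤L′ = begin
    t                                     ≤⟨ t≤L ⟩
    (N + 2) * (suc k + 1)                 ≤⟨ m≤m+n _ (2 * k + 3) ⟩
    (N + 2) * (suc k + 1) + (2 * k + 3)   ≡⟨ solve (N ∷ k ∷ []) ⟩
    suc ((2 + N + 2) * (k + 1) + (2 + N)) ∎

arcSplit-i+k*4 : ∀ i k t → i ≤ 4 → 3 + (i + k * 4) ≤ t →
  8 * t + 11 ≤ (5 + (i + k * 4)) * (5 + (i + k * 4)) + 2 * (5 + (i + k * 4)) →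
  ArcSplit (5 + (i + k * 4)) t
arcSplit-i+k*4 i k t i≤4 lo hi =
  subst (λ m → ArcSplit (5 + m) t) (sym regroup)
    (arcSplit-interval k (i + 2 * k) t (subst (λ m → 3 + m ≤ t) regroup lo) t≤U)
  where
  regroup : i + k * 4 ≡ i + 2 * k + 2 * k
  regroup = solve (i ∷ k ∷ [])
  -- The top U of the interval has 8U + 11 = n² + 2n + i(4 − i), here moved to avoid subtraction.
  slack : (5 + (i + k * 4)) * (5 + (i + k * 4)) + 2 * (5 + (i + k * 4)) + 4 * i
        ≡ 8 * suc ((i + 2 * k + 2) * (k + 1) + (i + 2 * k)) + 11 + i * i
  slack = solve (i ∷ k ∷ [])
  open ≤-Reasoning
  8t≤8U : 8 * t + 11 + i * i ≤ 8 * suc ((i + 2 * k + 2) * (k + 1) + (i + 2 * k)) + 11 + i * i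
  8t≤8U = begin
    8 * t + 11 + i * i        ≤⟨ +-monoʳ-≤ (8 * t + 11) (*-monoˡ-≤ i i≤4) ⟩
    8 * t + 11 + 4 * i        ≤⟨ +-monoˡ-≤ (4 * i) hi ⟩
    _                         ≡⟨ slack ⟩
    _                         ∎
  t≤U : t ≤ suc ((i + 2 * k + 2) * (k + 1) + (i + 2 * k))
  t≤U = *-cancelˡ-≤ 8 (+-cancelʳ-≤ 11 _ _ (+-cancelʳ-≤ (i * i) _ _ 8t≤8U))

arcSplit : ∀ n t → 5 ≤ n → n ∸ 2 ≤ t → 8 * t + 11 ≤ n * n + 2 * n → ArcSplit n t
arcSplit n t 5≤n lo hi with m≤n⇒∃[o]m+o≡n 5≤n
... | m , refl with m divMod 4
...   | result k r refl = arcSplit-i+k*4 (toℕ r) k t (<⇒≤ (toℕ<n r)) lo hi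

-- Crossings in a convex polygon

module _ {n : ℕ} where
  open import Data.List.Relation.Unary.All using ([]; _∷_; lookup)
  open import Data.List.Relation.Unary.AllPairs using (AllPairs; []; _∷_)

  cross-sym : ∀ {e f : Edge n} → Cross e f → Cross f e
  cross-sym (inj₁ c) = inj₂ c
  cross-sym (inj₂ c) = inj₁ c

  cross-irrefl : ∀ (e : Edge n) → ¬ Cross e e
  cross-irrefl _ (inj₁ (a<a , _)) = <-irrefl refl a<a
  cross-irrefl _ (inj₂ (a<a , _)) = <-irrefl refl a<a

  cross⇒isDiagonal : ∀ {e f : Edge n} → Cross e f → IsDiagonal f
  cross⇒isDiagonal {a , b} {c , d} (inj₁ (a<c , c<b , b<d)) =
    ≤-trans (s≤s c<b) b<d , λ (c≡0 , _) → <⇒≢ (≤-<-trans z≤n a<c) (sym c≡0)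
  cross⇒isDiagonal {a , b} {c , d} (inj₂ (c<a , a<d , d<b)) =
    ≤-trans (s≤s c<a) a<d , λ (_ , 1+d≡n) → <-irrefl 1+d≡n (<-≤-trans (s≤s d<b) (toℕ<n b))

  cross? : ∀ (e f : Edge n) → Dec (Cross e f)
  cross? (a , b) (c , d) =
    (toℕ a <? toℕ c ×-dec toℕ c <? toℕ b ×-dec toℕ b <? toℕ d) ⊎-dec
    (toℕ c <? toℕ a ×-dec toℕ a <? toℕ d ×-dec toℕ d <? toℕ b)

  isDiagonal? : ∀ (e : Edge n) → Dec (IsDiagonal e)
  isDiagonal? (i , j) = suc (toℕ i) <? toℕ j ×-dec ¬? (toℕ i ≟ 0 ×-dec suc (toℕ j) ≟ n)

  ¬cross-shareˡ : ∀ (u v w : Fin n) → ¬ Cross (u , v) (u , w)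
  ¬cross-shareˡ _ _ _ (inj₁ (u<u , _)) = <-irrefl refl u<u
  ¬cross-shareˡ _ _ _ (inj₂ (u<u , _)) = <-irrefl refl u<u

  ¬cross-shareʳ : ∀ (u v w : Fin n) → ¬ Cross (u , w) (v , w)
  ¬cross-shareʳ _ _ _ (inj₁ (_ , _ , w<w)) = <-irrefl refl w<w
  ¬cross-shareʳ _ _ _ (inj₂ (_ , _ , w<w)) = <-irrefl refl w<w

  ¬cross-chain : ∀ (u v w : Fin n) → ¬ Cross (u , v) (v , w)
  ¬cross-chain _ _ _ (inj₁ (_ , v<v , _)) = <-irrefl refl v<v
  ¬cross-chain _ _ _ (inj₂ (v<u , u<w , w<v)) = <-asym v<u (<-trans u<w w<v)

  ¬cross-disjoint : ∀ (u v w x : Fin n) → toℕ v < toℕ w → ¬ Cross (u , v) (w , x)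
  ¬cross-disjoint _ _ _ _ v<w (inj₁ (_ , w<v , _)) = <-asym v<w w<v
  ¬cross-disjoint _ _ _ _ v<w (inj₂ (w<u , u<x , x<v)) = <-asym v<w (<-trans w<u (<-trans u<x x<v))

  ¬cross-nested : ∀ (u v w x : Fin n) → toℕ u < toℕ w → toℕ x < toℕ v → ¬ Cross (u , v) (w , x)
  ¬cross-nested _ _ _ _ _ x<v (inj₁ (_ , _ , v<x)) = <-asym v<x x<v
  ¬cross-nested _ _ _ _ u<w _ (inj₂ (w<u , _)) = <-asym w<u u<w

  Noncrossing : List (Edge n) → Set
  Noncrossing S = ∀ {e f} → e ∈ S → f ∈ S → ¬ Cross e f

  allPairs⇒noncrossing : ∀ {S} → AllPairs (λ e f → ¬ Cross e f) S → Noncrossing S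
  allPairs⇒noncrossing (_ ∷ _) (here refl) (here refl) = cross-irrefl _
  allPairs⇒noncrossing (e∤ ∷ _) (here refl) (there f∈) = lookup e∤ f∈
  allPairs⇒noncrossing (f∤ ∷ _) (there e∈) (here refl) = lookup f∤ e∈ ∘ cross-sym
  allPairs⇒noncrossing (_ ∷ ps) (there e∈) (there f∈) = allPairs⇒noncrossing ps e∈ f∈

  ¬cross-flip : ∀ {e f : Edge n} → ¬ Cross e f → ¬ Cross f e
  ¬cross-flip ¬e×f f×e = ¬e×f (cross-sym f×e)

  quadrilateral : Fin n → Fin n → Fin n → Fin n → List (Edge n)
  quadrilateral p q r s = (p , q) ∷ (q , r) ∷ (r , s) ∷ (p , s) ∷ []

  module _ {p q r s : Fin n} (p<q : toℕ p < toℕ q) (q<r : toℕ q < toℕ r) (r<s : toℕ r < toℕ s) where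

    quadrilateral-pairwise : AllPairs (λ e f → ¬ Cross e f) (quadrilateral p q r s)
    quadrilateral-pairwise =
      (¬cross-chain p q r ∷ ¬cross-disjoint p q r s q<r ∷ ¬cross-shareˡ p q s ∷ []) ∷
      (¬cross-chain q r s ∷ ¬cross-flip (¬cross-nested p s q r p<q r<s) ∷ []) ∷
      (¬cross-shareʳ r p s ∷ []) ∷ [] ∷ []

    quadrilateral+pr-noncrossing : Noncrossing ((p , r) ∷ quadrilateral p q r s)
    quadrilateral+pr-noncrossing = allPairs⇒noncrossing
      ((¬cross-shareˡ p r q ∷ ¬cross-shareʳ p q r ∷ ¬cross-chain p r s ∷ ¬cross-shareˡ p r s ∷ []) ∷
       quadrilateral-pairwise)

    quadrilateral+qs-noncrossing : Noncrossing ((q , s) ∷ quadrilateral p q r s)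
    quadrilateral+qs-noncrossing = allPairs⇒noncrossing
      ((¬cross-flip (¬cross-chain p q s) ∷ ¬cross-shareˡ q s r ∷ ¬cross-shareʳ q r s ∷ ¬cross-shareʳ q p s ∷ []) ∷
       quadrilateral-pairwise)

  -- Completing non-crossing diagonals to a triangulation

  IsPartialTriangulation : List (Edge n) → Set
  IsPartialTriangulation S = (∀ {e} → e ∈ S → IsDiagonal e) × Noncrossing S

  Compatible : List (Edge n) → Edge n → Set
  Compatible S d = IsDiagonal d × ¬ Any (Cross d) S

  compatible? : ∀ S d → Dec (Compatible S d)
  compatible? S d = isDiagonal? d ×-dec ¬? (any? (cross? d) S)

  addIfCompatible : Edge n → List (Edge n) → List (Edge n)
  addIfCompatible d S with compatible? S d
  ... | yes _ = d ∷ S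
  ... | no  _ = S

  add-preserves : ∀ d {S} → IsPartialTriangulation S → IsPartialTriangulation (addIfCompatible d S)
  add-preserves d {S} (diagonal , noncrossing) with compatible? S d
  ... | no _ = diagonal , noncrossing
  ... | yes (d-diagonal , d∤S) = diagonal′ , noncrossing′
    where
    diagonal′ : ∀ {e} → e ∈ d ∷ S → IsDiagonal e
    diagonal′ (here refl) = d-diagonal
    diagonal′ (there e∈S) = diagonal e∈S
    noncrossing′ : Noncrossing (d ∷ S)
    noncrossing′ (here refl) (here refl) = cross-irrefl d
    noncrossing′ (here refl) (there f∈S) d×f = d∤S (lose f∈S d×f)
    noncrossing′ (there e∈S) (here refl) e×d = d∤S (lose e∈S (cross-sym e×d))
    noncrossing′ (there e∈S) (there f∈S) = noncrossing e∈S f∈S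

  ⊆-add : ∀ d S → S ⊆ addIfCompatible d S
  ⊆-add d S e∈S with compatible? S d
  ... | yes _ = there e∈S
  ... | no  _ = e∈S

  Covered : List (Edge n) → Edge n → Set
  Covered S d = d ∈ S ⊎ ∃[ e ] (e ∈ S × Cross d e) ⊎ ¬ IsDiagonal d

  covered-mono : ∀ {S S′ d} → S ⊆ S′ → Covered S d → Covered S′ d
  covered-mono S⊆S′ (inj₁ d∈S) = inj₁ (S⊆S′ d∈S)
  covered-mono S⊆S′ (inj₂ (inj₁ (e , e∈S , d×e))) = inj₂ (inj₁ (e , S⊆S′ e∈S , d×e))
  covered-mono S⊆S′ (inj₂ (inj₂ ¬diagonal)) = inj₂ (inj₂ ¬diagonal)

  add-covers : ∀ d S → Covered (addIfCompatible d S) d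
  add-covers d S with compatible? S d
  ... | yes _ = inj₁ (here refl)
  ... | no incompatible with isDiagonal? d | any? (cross? d) S
  ...   | no ¬diagonal | _        = inj₂ (inj₂ ¬diagonal)
  ...   | yes _        | yes d×S  = inj₂ (inj₁ (find d×S))
  ...   | yes diagonal | no  d∤S  = contradiction (diagonal , d∤S) incompatible

  extend : List (Edge n) → List (Edge n) → List (Edge n)
  extend S = foldr addIfCompatible S

  extend-preserves : ∀ {S} → IsPartialTriangulation S → ∀ ds → IsPartialTriangulation (extend S ds)
  extend-preserves p []       = p
  extend-preserves p (d ∷ ds) = add-preserves d (extend-preserves p ds)

  ⊆-extend : ∀ {S} ds → S ⊆ extend S ds
  ⊆-extend []       e∈S = e∈S
  ⊆-extend (d ∷ ds) e∈S = ⊆-add d _ (⊆-extend ds e∈S)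

  extend-covers : ∀ {S d} ds → d ∈ ds → Covered (extend S ds) d
  extend-covers (d ∷ ds) (here refl) = add-covers d _
  extend-covers (d ∷ ds) (there d′∈) = covered-mono (⊆-add d _) (extend-covers ds d′∈)

  allEdges : List (Edge n)
  allEdges = cartesianProduct (allFin n) (allFin n)

  ∈-allEdges : ∀ (e : Edge n) → e ∈ allEdges
  ∈-allEdges (i , j) = ∈-cartesianProduct⁺ (∈-allFin i) (∈-allFin j)

  extendToTriangulation : ∀ {S} → IsPartialTriangulation S → ∃[ T ] (IsTriangulation T × S ⊆ T)
  extendToTriangulation {S} p = T , triangulation , ⊆-extend allEdges
    where
    T = extend S allEdges
    partial = extend-preserves p allEdges
    maximal : ∀ d → IsDiagonal d → d ∉ T → ∃[ e ] (e ∈ T × Cross d e)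
    maximal d diagonal d∉T with extend-covers allEdges (∈-allEdges d)
    ... | inj₁ d∈T               = contradiction d∈T d∉T
    ... | inj₂ (inj₁ crossing)   = crossing
    ... | inj₂ (inj₂ ¬diagonal)  = contradiction diagonal ¬diagonal
    triangulation : IsTriangulation T
    triangulation = record
      { diagonals   = λ _ → proj₁ partial
      ; nonCrossing = λ _ _ → proj₂ partial
      ; maximal     = maximal
      }

  diagonalsOf : List (Edge n) → List (Edge n)
  diagonalsOf = filter isDiagonal?

  diagonalsOf-partial : ∀ N → Noncrossing N → IsPartialTriangulation (diagonalsOf N)
  diagonalsOf-partial N noncrossing =
    proj₂ ∘ ∈-filter⁻′ , λ e∈ f∈ → noncrossing (proj₁ (∈-filter⁻′ e∈)) (proj₁ (∈-filter⁻′ f∈))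
    where
    ∈-filter⁻′ : ∀ {e} → e ∈ diagonalsOf N → e ∈ N × IsDiagonal e
    ∈-filter⁻′ = ∈-filter⁻ isDiagonal? {xs = N}

  ¬IsBlocker-if-crossed : ∀ (P : Edge n → Set) (N : List (Edge n)) → Noncrossing N →
    (∀ s → P s → ∃[ m ] (m ∈ N × Cross s m)) → ¬ IsBlocker P
  ¬IsBlocker-if-crossed P N noncrossing crossed (_ , blocks)
    with extendToTriangulation (diagonalsOf-partial N noncrossing)
  ... | T , triangulation , N⊆T with blocks T triangulation
  ...   | s , Ps , s∈T with crossed s Ps
  ...     | m , m∈N , s×m = IsTriangulation.nonCrossing triangulation s m s∈T m∈T s×m
    where
    m∈T : m ∈ T
    m∈T = N⊆T (∈-filter⁺ isDiagonal? m∈N (cross⇒isDiagonal s×m))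

-- Widening a side of a triangulation

predecessor : ∀ {n} (x : Fin n) → 0 < toℕ x → ∃[ w ] (toℕ x ≡ suc (toℕ w))
predecessor {n} x 0<x with m≤n⇒∃[o]m+o≡n 0<x
... | o , 1+o≡x = fromℕ< o<n , trans (sym 1+o≡x) (cong suc (sym (toℕ-fromℕ< o<n)))
  where
  o<n : o < n
  o<n = ≤-trans (≤-reflexive 1+o≡x) (<⇒≤ (toℕ<n x))

module _ {n : ℕ} {T : List (Edge n)} (triangulation : IsTriangulation T) where
  open IsTriangulation triangulation
  open import Data.List.Membership.DecPropositional (≡-dec (_≟ᶠ_ {n}) (_≟ᶠ_ {n})) using (_∈?_)

  -- The boundary edge (0, n − 1) is not counted as a side.
  Side : Fin n → Fin n → Set
  Side x y = (x , y) ∈ T ⊎ toℕ y ≡ suc (toℕ x)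

  side⇒< : ∀ {x y} → Side x y → toℕ x < toℕ y
  side⇒< (inj₁ xy∈T)  = <⇒≤ (proj₁ (diagonals _ xy∈T))
  side⇒< (inj₂ y≡1+x) = ≤-reflexive (sym y≡1+x)

  side-¬cross : ∀ {x y f} → Side x y → f ∈ T → ¬ Cross (x , y) f
  side-¬cross (inj₁ xy∈T)  f∈T = nonCrossing _ _ xy∈T f∈T
  side-¬cross (inj₂ y≡1+x) _ (inj₁ (x<p , p<y , _)) = <⇒≱ x<p (≤-pred (subst (_ <_) y≡1+x p<y))
  side-¬cross (inj₂ y≡1+x) _ (inj₂ (_ , x<q , q<y)) = <⇒≱ x<q (≤-pred (subst (_ <_) y≡1+x q<y))

  Widening : Fin n → Fin n → Set
  Widening x y = ∃[ z ] ((toℕ z < toℕ x × (z , y) ∈ T) ⊎ (toℕ y < toℕ z × (x , z) ∈ T))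

  -- Walk down the fan of x: while w–x is a side, either w–y is in T, or the edge of T that
  -- crosses w–y can cross neither w–x nor x–y, so it ends at x, either above y (done) or
  -- below w (continue from its other endpoint).
  side-widens : ∀ {x y} → Side x y → 0 < toℕ x → suc (toℕ y) < n → Widening x y
  side-widens {x} {y} xy 0<x 1+y<n =
    let w , x≡1+w = predecessor x 0<x
    in search w (<-wellFounded _) (≤-reflexive (sym x≡1+w)) (inj₂ x≡1+w)
    where
    x<y = side⇒< xy
    search : ∀ w → Acc _<_ (toℕ w) → toℕ w < toℕ x → Side w x → Widening x y
    search w (acc rec) w<x wx with (w , y) ∈? T
    ... | yes wy∈T = w , inj₁ (w<x , wy∈T)
    ... | no  wy∉T with maximal (w , y) (≤-trans (s≤s w<x) x<y , λ (_ , 1+y≡n) → <-irrefl 1+y≡n 1+y<n) wy∉T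
    ...   | (p , q) , pq∈T , inj₁ (w<p , p<y , y<q) with <-cmp (toℕ p) (toℕ x)
    ...     | tri< p<x _ _ = contradiction (inj₁ (w<p , p<x , <-trans x<y y<q)) (side-¬cross wx pq∈T)
    ...     | tri> _ _ x<p = contradiction (inj₁ (x<p , p<y , y<q)) (side-¬cross xy pq∈T)
    ...     | tri≈ _ p≡x _ = q , inj₂ (y<q , subst (λ p → (p , q) ∈ T) (toℕ-injective p≡x) pq∈T)
    search w (acc rec) w<x wx | no _ | (p , q) , pq∈T , inj₂ (p<w , w<q , q<y) with <-cmp (toℕ q) (toℕ x)
    ...     | tri< q<x _ _ = contradiction (inj₂ (p<w , w<q , q<x)) (side-¬cross wx pq∈T)
    ...     | tri> _ _ x<q = contradiction (inj₂ (<-trans p<w w<x , x<q , q<y)) (side-¬cross xy pq∈T)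
    ...     | tri≈ _ q≡x _ =
      search p (rec p<w) (<-trans p<w w<x) (inj₁ (subst (λ q → (p , q) ∈ T) (toℕ-injective q≡x) pq∈T))

length-cartesianProduct : ∀ {A B : Set} (xs : List A) (ys : List B) →
  length (cartesianProduct xs ys) ≡ length xs * length ys
length-cartesianProduct []       ys = refl
length-cartesianProduct (x ∷ xs) ys = begin
  length (map (x ,_) ys ++ cartesianProduct xs ys)
    ≡⟨ length-++ (map (x ,_) ys) ⟩
  length (map (x ,_) ys) + length (cartesianProduct xs ys)
    ≡⟨ cong₂ _+_ (length-map (x ,_) ys) (length-cartesianProduct xs ys) ⟩
  length ys + length xs * length ys
    ∎
  where open ≡-Reasoning

module _ {n : ℕ} where

  arcVertex : ∀ o k → o + k ≤ n → Fin k → Fin n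
  arcVertex o k o+k≤n i = fromℕ< (<-≤-trans (+-monoʳ-< o (toℕ<n i)) o+k≤n)

  toℕ-arcVertex : ∀ o k (o+k≤n : o + k ≤ n) (i : Fin k) → toℕ (arcVertex o k o+k≤n i) ≡ o + toℕ i
  toℕ-arcVertex o k o+k≤n i = toℕ-fromℕ< _

  -- Opaque, so that the implicit arguments of the lemmas below are inferred from v ∈ arc o k _.
  opaque
    arc : ∀ o k → o + k ≤ n → List (Fin n)
    arc o k o+k≤n = tabulate (arcVertex o k o+k≤n)

  opaque
    unfolding arc

    length-arc : ∀ o k (o+k≤n : o + k ≤ n) → length (arc o k o+k≤n) ≡ k
    length-arc o k o+k≤n = length-tabulate _

    arc-unique : ∀ o k (o+k≤n : o + k ≤ n) → Unique (arc o k o+k≤n)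
    arc-unique o k o+k≤n = Unique.tabulate⁺ λ {i} {j} eq →
      toℕ-injective (+-cancelˡ-≡ o _ _ (trans (sym (toℕ-arcVertex o k o+k≤n i))
                                        (trans (cong toℕ eq) (toℕ-arcVertex o k o+k≤n j))))

    ∈-arc⁻ : ∀ {o k} {o+k≤n : o + k ≤ n} {v} → v ∈ arc o k o+k≤n → o ≤ toℕ v × toℕ v < o + k
    ∈-arc⁻ {o} {k} {o+k≤n} v∈ with ∈-tabulate⁻ v∈
    ... | i , refl rewrite toℕ-arcVertex o k o+k≤n i = m≤m+n o (toℕ i) , +-monoʳ-< o (toℕ<n i)

    ∈-arc⁺ : ∀ {o k} {o+k≤n : o + k ≤ n} {v} → o ≤ toℕ v → toℕ v < o + k → v ∈ arc o k o+k≤n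
    ∈-arc⁺ {o} {k} {o+k≤n} {v} o≤v v<o+k with m≤n⇒∃[o]m+o≡n o≤v
    ... | j , o+j≡v = subst (_∈ arc o k o+k≤n) (toℕ-injective toℕ-vertex) (∈-tabulate⁺ (fromℕ< j<k))
      where
      j<k : j < k
      j<k = +-cancelˡ-< o j k (subst (_< o + k) (sym o+j≡v) v<o+k)
      toℕ-vertex : toℕ (arcVertex o k o+k≤n (fromℕ< j<k)) ≡ toℕ v
      toℕ-vertex = trans (toℕ-arcVertex o k o+k≤n (fromℕ< j<k)) (trans (cong (o +_) (toℕ-fromℕ< j<k)) o+j≡v)

  vertexBetween : ∀ {lo hi} → lo < hi → hi ≤ n → ∃[ v ] (lo ≤ toℕ v × toℕ v < hi)
  vertexBetween lo<hi hi≤n = fromℕ< (<-≤-trans lo<hi hi≤n) ,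
    ≤-reflexive (sym (toℕ-fromℕ< _)) , subst (_< _) (sym (toℕ-fromℕ< _)) lo<hi

  boundaryEdge : ∀ m → suc m < n → ∃[ x ] ∃[ y ] (toℕ x ≡ m × toℕ y ≡ suc m)
  boundaryEdge m 1+m<n = fromℕ< (<-trans (n<1+n m) 1+m<n) , fromℕ< 1+m<n , toℕ-fromℕ< _ , toℕ-fromℕ< _

-- The four-arc blocker

module FourArcs (a b c d : ℕ) where

  α β γ n : ℕ
  α = suc a
  β = α + suc b
  γ = β + suc c
  n = γ + suc d

  α<β : α < β
  α<β = m<m+n α z<s
  β<γ : β < γ
  β<γ = m<m+n β z<s
  γ<n : γ < n
  γ<n = m<m+n γ z<s
  α≤n : α ≤ n
  α≤n = <⇒≤ (<-trans α<β (<-trans β<γ γ<n))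
  β≤n : β ≤ n
  β≤n = <⇒≤ (<-trans β<γ γ<n)
  γ≤n : γ ≤ n
  γ≤n = <⇒≤ γ<n

  I₁ I₂ I₃ I₄ : List (Fin n)
  I₁ = arc 0 α α≤n
  I₂ = arc α (suc b) β≤n
  I₃ = arc β (suc c) γ≤n
  I₄ = arc γ (suc d) ≤-refl

  blocker : List (Edge n)
  blocker = cartesianProduct I₁ I₃ ++ cartesianProduct I₂ I₄

  InBlocker : Edge n → Set
  InBlocker (x , y) = (toℕ x < α × β ≤ toℕ y × toℕ y < γ) ⊎ (α ≤ toℕ x × toℕ x < β × γ ≤ toℕ y)

  ∈-blocker⁻ : ∀ {e} → e ∈ blocker → InBlocker e
  ∈-blocker⁻ e∈ with ∈-++⁻ (cartesianProduct I₁ I₃) e∈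
  ... | inj₁ e∈₁₃ = let x∈ , y∈ = ∈-cartesianProduct⁻ I₁ I₃ e∈₁₃ in inj₁ (proj₂ (∈-arc⁻ x∈) , ∈-arc⁻ y∈)
  ... | inj₂ e∈₂₄ = let x∈ , y∈ = ∈-cartesianProduct⁻ I₂ I₄ e∈₂₄; α≤x , x<β = ∈-arc⁻ x∈
                    in inj₂ (α≤x , x<β , proj₁ (∈-arc⁻ y∈))

  ∈-blocker⁺ : ∀ {e} → InBlocker e → e ∈ blocker
  ∈-blocker⁺ {x , y} (inj₁ (x<α , β≤y , y<γ)) =
    ∈-++⁺ˡ (∈-cartesianProduct⁺ (∈-arc⁺ z≤n x<α) (∈-arc⁺ β≤y y<γ))
  ∈-blocker⁺ {x , y} (inj₂ (α≤x , x<β , γ≤y)) =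
    ∈-++⁺ʳ (cartesianProduct I₁ I₃) (∈-cartesianProduct⁺ (∈-arc⁺ α≤x x<β) (∈-arc⁺ γ≤y (toℕ<n y)))

  length-blocker : length blocker ≡ α * suc c + suc b * suc d
  length-blocker = begin
    length blocker
      ≡⟨ length-++ (cartesianProduct I₁ I₃) ⟩
    length (cartesianProduct I₁ I₃) + length (cartesianProduct I₂ I₄)
      ≡⟨ cong₂ _+_ (length-cartesianProduct I₁ I₃) (length-cartesianProduct I₂ I₄) ⟩
    length I₁ * length I₃ + length I₂ * length I₄
      ≡⟨ cong₂ _+_ (cong₂ _*_ (length-arc _ _ _) (length-arc _ _ _)) (cong₂ _*_ (length-arc _ _ _) (length-arc _ _ _)) ⟩
    α * suc c + suc b * suc d
      ∎
    where open ≡-Reasoning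

  blocker-unique : Unique blocker
  blocker-unique = Unique.++⁺ (Unique.cartesianProduct⁺ (arc-unique _ _ _) (arc-unique _ _ _))
                              (Unique.cartesianProduct⁺ (arc-unique _ _ _) (arc-unique _ _ _))
                              disjoint
    where
    disjoint : ∀ {e} → ¬ (e ∈ cartesianProduct I₁ I₃ × e ∈ cartesianProduct I₂ I₄)
    disjoint (e∈₁₃ , e∈₂₄) =
      <⇒≱ (proj₂ (∈-arc⁻ (proj₁ (∈-cartesianProduct⁻ I₁ I₃ e∈₁₃))))
          (proj₁ (∈-arc⁻ (proj₁ (∈-cartesianProduct⁻ I₂ I₄ e∈₂₄))))

  inBlocker⇒isDiagonal : ∀ {e} → InBlocker e → IsDiagonal e
  inBlocker⇒isDiagonal (inj₁ (x<α , β≤y , y<γ)) =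
    ≤-trans (s≤s x<α) (≤-trans α<β β≤y) , λ (_ , 1+y≡n) → <-irrefl 1+y≡n (≤-trans (s≤s y<γ) γ<n)
  inBlocker⇒isDiagonal (inj₂ (α≤x , x<β , γ≤y)) =
    ≤-trans (s≤s x<β) (≤-trans β<γ γ≤y) , λ (x≡0 , _) → <⇒≢ (≤-trans z<s α≤x) (sym x≡0)

  blocks : ∀ T → IsTriangulation T → ∃[ e ] (InBlocker e × e ∈ T)
  blocks T triangulation with boundaryEdge (α + b) (subst (_< n) (+-suc α b) (<-trans β<γ γ<n))
  ... | x₀ , y₀ , x₀≡α+b , y₀≡1+α+b =
    grow x₀ y₀ (<-wellFounded _)
      (subst (α ≤_) (sym x₀≡α+b) (m≤m+n α b))
      (subst (_< β) (sym x₀≡α+b) (+-monoʳ-< α (n<1+n b)))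
      (≤-reflexive (trans (+-suc α b) (sym y₀≡1+α+b)))
      (subst (_< γ) (trans (+-suc α b) (sym y₀≡1+α+b)) β<γ)
      (inj₂ (trans y₀≡1+α+b (cong suc (sym x₀≡α+b))))
    where
    Found = ∃[ e ] (InBlocker e × e ∈ T)
    grow : ∀ x y → Acc _<_ (toℕ x + (n ∸ toℕ y)) → α ≤ toℕ x → toℕ x < β → β ≤ toℕ y → toℕ y < γ →
           Side triangulation x y → Found
    grow x y (acc rec) α≤x x<β β≤y y<γ xy
      with side-widens triangulation xy (≤-trans z<s α≤x) (≤-trans (s≤s y<γ) γ<n)
    ... | z , inj₁ (z<x , zy∈T) with toℕ z <? α
    ...   | yes z<α = (z , y) , inj₁ (z<α , β≤y , y<γ) , zy∈T
    ...   | no  z≮α = grow z y (rec (+-monoˡ-< _ z<x)) (≮⇒≥ z≮α) (<-trans z<x x<β) β≤y y<γ (inj₁ zy∈T)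
    grow x y (acc rec) α≤x x<β β≤y y<γ xy | z , inj₂ (y<z , xz∈T) with toℕ z <? γ
    ...   | yes z<γ = grow x z (rec (+-monoʳ-< (toℕ x) (∸-monoʳ-< y<z (<⇒≤ (toℕ<n z)))))
                           α≤x x<β (≤-trans β≤y (<⇒≤ y<z)) z<γ (inj₁ xz∈T)
    ...   | no  z≮γ = (x , z) , inj₂ (α≤x , x<β , ≮⇒≥ z≮γ) , xz∈T

  saturated₁₃ : ∀ {X Y} → toℕ X < α → β ≤ toℕ Y → toℕ Y < γ →
    ¬ IsBlocker (λ s → s ∈ blocker × s ≢ (X , Y))
  saturated₁₃ {X} {Y} X<α β≤Y Y<γ with vertexBetween α<β β≤n | vertexBetween γ<n ≤-refl
  ... | B , α≤B , B<β | L , γ≤L , _ =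
    ¬IsBlocker-if-crossed _ ((X , Y) ∷ quadrilateral X B Y L)
      (quadrilateral+pr-noncrossing X<B B<Y Y<L) crossed
    where
    X<B = <-≤-trans X<α α≤B
    B<Y = <-≤-trans B<β β≤Y
    Y<L = <-≤-trans Y<γ γ≤L
    crossed : ∀ s → s ∈ blocker × s ≢ (X , Y) → ∃[ m ] (m ∈ (X , Y) ∷ quadrilateral X B Y L × Cross s m)
    crossed (x , y) (s∈ , s≢XY) with ∈-blocker⁻ s∈
    ... | inj₂ (α≤x , x<β , γ≤y) =
      (X , Y) , here refl , inj₂ (<-≤-trans X<α α≤x , <-≤-trans x<β β≤Y , <-≤-trans Y<γ γ≤y)
    ... | inj₁ (x<α , β≤y , y<γ) with <-cmp (toℕ x) (toℕ X)
    ...   | tri< x<X _ _ = (X , L) , there (there (there (there (here refl)))) ,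
                           inj₁ (x<X , <-trans X<B (<-≤-trans B<β β≤y) , <-≤-trans y<γ γ≤L)
    ...   | tri> _ _ X<x = (X , B) , there (here refl) ,
                           inj₂ (X<x , <-≤-trans x<α α≤B , <-≤-trans B<β β≤y)
    ...   | tri≈ _ x≡X _ with <-cmp (toℕ y) (toℕ Y)
    ...     | tri< y<Y _ _ = (B , Y) , there (there (here refl)) ,
                             inj₁ (<-≤-trans x<α α≤B , <-≤-trans B<β β≤y , y<Y)
    ...     | tri> _ _ Y<y = (Y , L) , there (there (there (here refl))) ,
                             inj₁ (<-trans (<-≤-trans x<α α≤B) B<Y , Y<y , <-≤-trans y<γ γ≤L)
    ...     | tri≈ _ y≡Y _ = contradiction (cong₂ _,_ (toℕ-injective x≡X) (toℕ-injective y≡Y)) s≢XY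

  saturated₂₄ : ∀ {X Y} → α ≤ toℕ X → toℕ X < β → γ ≤ toℕ Y →
    ¬ IsBlocker (λ s → s ∈ blocker × s ≢ (X , Y))
  saturated₂₄ {X} {Y} α≤X X<β γ≤Y with vertexBetween z<s α≤n | vertexBetween β<γ γ≤n
  ... | A , _ , A<α | G , β≤G , G<γ =
    ¬IsBlocker-if-crossed _ ((X , Y) ∷ quadrilateral A X G Y)
      (quadrilateral+qs-noncrossing A<X X<G G<Y) crossed
    where
    A<X = <-≤-trans A<α α≤X
    X<G = <-≤-trans X<β β≤G
    G<Y = <-≤-trans G<γ γ≤Y
    crossed : ∀ s → s ∈ blocker × s ≢ (X , Y) → ∃[ m ] (m ∈ (X , Y) ∷ quadrilateral A X G Y × Cross s m)
    crossed (x , y) (s∈ , s≢XY) with ∈-blocker⁻ s∈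
    ... | inj₁ (x<α , β≤y , y<γ) =
      (X , Y) , here refl , inj₁ (<-≤-trans x<α α≤X , <-≤-trans X<β β≤y , <-≤-trans y<γ γ≤Y)
    ... | inj₂ (α≤x , x<β , γ≤y) with <-cmp (toℕ x) (toℕ X)
    ...   | tri< x<X _ _ = (A , X) , there (here refl) ,
                           inj₂ (<-≤-trans A<α α≤x , x<X , <-trans X<G (<-≤-trans G<γ γ≤y))
    ...   | tri> _ _ X<x = (X , G) , there (there (here refl)) ,
                           inj₂ (X<x , <-≤-trans x<β β≤G , <-≤-trans G<γ γ≤y)
    ...   | tri≈ _ x≡X _ with <-cmp (toℕ y) (toℕ Y)
    ...     | tri< y<Y _ _ = (G , Y) , there (there (there (here refl))) ,
                             inj₁ (<-≤-trans x<β β≤G , <-≤-trans G<γ γ≤y , y<Y)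
    ...     | tri> _ _ Y<y = (A , Y) , there (there (there (there (here refl)))) ,
                             inj₂ (<-≤-trans A<α α≤x , <-trans (<-≤-trans x<β β≤G) G<Y , Y<y)
    ...     | tri≈ _ y≡Y _ = contradiction (cong₂ _,_ (toℕ-injective x≡X) (toℕ-injective y≡Y)) s≢XY

  saturated : ∀ e → e ∈ blocker → ¬ IsBlocker (λ s → s ∈ blocker × s ≢ e)
  saturated (X , Y) e∈ with ∈-blocker⁻ e∈
  ... | inj₁ (X<α , β≤Y , Y<γ) = saturated₁₃ X<α β≤Y Y<γ
  ... | inj₂ (α≤X , X<β , γ≤Y) = saturated₂₄ α≤X X<β γ≤Y

  blocker-isNTBlocker : IsNTBlocker n (α * suc c + suc b * suc d) blocker
  blocker-isNTBlocker =
    blocker-unique , length-blocker ,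
    ((λ _ → inBlocker⇒isDiagonal ∘ ∈-blocker⁻) ,
     (λ T triangulation → let e , inBlocker , e∈T = blocks T triangulation in e , ∈-blocker⁺ inBlocker , e∈T)) ,
    saturated

lemma3p3 : (n t : ℕ) → 5 ≤ n → n ∸ 2 ≤ t → 8 * t + 11 ≤ n * n + 2 * n →
    ∃[ B ] IsNTBlocker n t B
lemma3p3 n t 5≤n lo hi with arcSplit n t 5≤n lo hi
... | a , b , c , d , refl , refl = FourArcs.blocker a b c d , FourArcs.blocker-isNTBlocker a b c d
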